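{- Let $n\ge1$ and let $D$ be either $\{(i,j):1\le i,j\le n,\ i+j\le n+1\}$ or $\{(i,j):1\le i,j\le n,\ i+j\ge n+1\}$ (a staircase grid of size $n$ whose diagonal runs from top-left to bottom-right). Then the downcore graph of $D$ is pure, and every maximal independent set of it has exactly $2n-1$ elements.
   Context: Boxes $(i,j)$ are indexed by column $i$ (from the left) and row $j$ (from the bottom). The downcore graph of a set $D$ of boxes has vertex set $D$, with an edge between $(i,j)$ and $(k,\ell)$ if and only if ($i<k$ and $j>\ell$, or $i>k$ and $j<\ell$) and both $(i,\ell)$ and $(k,j)$ belong to $D$. A graph is pure if all its maximal (with respect to inclusion) independent sets have the same size. -}

module Defs where

open import Data.Nat using (ℕ; _+_; _*_; _∸_; _≤_; _<_; _>_; _≥_)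
open import Data.Product using (_×_; _,_)
open import Data.Sum using (_⊎_)
open import Data.List using (List; length)
open import Data.List.Membership.Propositional using (_∈_)
open import Data.List.Relation.Unary.All using (All)
open import Data.List.Relation.Unary.Unique.Propositional using (Unique)
open import Relation.Nullary using (¬_)
open import Relation.Binary.PropositionalEquality using (_≡_)

-- A box (i , j): column i (from the left), row j (from the bottom).
Box : Set
Box = ℕ × ℕ

BoxSet : Set₁
BoxSet = Box → Set

DowncoreAdj : BoxSet → Box → Box → Set
DowncoreAdj D (i , j) (k , l) =
  ((i < k × j > l) ⊎ (i > k × j < l)) × D (i , l) × D (k , j)

Independent : BoxSet → List Box → Set
Independent D S =
  Unique S × All D S ×
  (∀ u v → u ∈ S → v ∈ S → ¬ DowncoreAdj D u v)

MaximalIndependent : BoxSet → List Box → Set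
MaximalIndependent D S =
  Independent D S ×
  (∀ T → Independent D T → (∀ x → x ∈ S → x ∈ T) → (∀ x → x ∈ T → x ∈ S))

PureDowncore : BoxSet → Set
PureDowncore D =
  ∀ S T → MaximalIndependent D S → MaximalIndependent D T → length S ≡ length T

StairLower : ℕ → BoxSet
StairLower n (i , j) = 1 ≤ i × i ≤ n × 1 ≤ j × j ≤ n × i + j ≤ n + 1

StairUpper : ℕ → BoxSet
StairUpper n (i , j) = 1 ≤ i × i ≤ n × 1 ≤ j × j ≤ n × i + j ≥ n + 1

PureOfSize : BoxSet → ℕ → Set
PureOfSize D n =
  PureDowncore D ×
  (∀ S → MaximalIndependent D S → length S ≡ 2 * n ∸ 1)

module Submission where

-- Both staircases are models of the intervals [a , b], 1 ≤ a ≤ b ≤ n: in the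
-- lower staircase the box (i , j) codes [i , n+1-j], in the upper one
-- [n+1-j , i], and two boxes are adjacent in the downcore graph exactly when
-- their intervals cross (overlap without being nested).  So a maximal
-- independent set is a maximal laminar (pairwise non-crossing) family of
-- intervals of [1 , n], and it suffices to count those.
--
-- A maximal laminar family S of a window [p , q], p < q,
-- contains [p , q]; if [p , m] is its longest other member starting at p,
-- then [m+1 , q] ∈ S and the members of S are those inside [p , m], those
-- inside [m+1 , q] (maximal laminar families of these windows) and [p , q].
-- Strong induction on the width gives 2 (q - p) + 1 members, hence 2n - 1
-- for [1 , n]; finally both staircases are shown to be interval models.

open import Defs
open import Data.Nat using (ℕ; zero; suc; _+_; _*_; _∸_; _≤_; _<_; _≤?_; z≤n; s≤s)
open import Data.Nat.Properties
open import Data.Nat.Induction using (<-wellFounded)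
open import Data.Nat.Tactic.RingSolver using (solve-∀)
open import Data.Product using (_×_; _,_; Σ; proj₁; proj₂)
open import Data.Product.Properties using (≡-dec)
open import Data.Sum using (_⊎_; inj₁; inj₂)
open import Data.List using (List; []; _∷_; length; filter)
open import Data.List.Membership.Propositional using (_∈_; find)
open import Data.List.Membership.Propositional.Properties using (∈-filter⁺; ∈-filter⁻)
open import Data.List.Relation.Unary.Any using (Any; here; there; any?)
import Data.List.Relation.Unary.Any as Any
open import Data.List.Relation.Unary.All using (_∷_)
import Data.List.Relation.Unary.All as All
open import Data.List.Relation.Unary.All.Properties using (¬Any⇒All¬)
open import Data.List.Relation.Unary.Unique.Propositional using (Unique)
open import Data.List.Relation.Unary.AllPairs using (_∷_)
import Data.List.Relation.Unary.Unique.Propositional.Properties as Unique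
open import Data.List.Membership.DecPropositional (≡-dec _≟_ _≟_) using (_∈?_)
open import Induction.WellFounded using (Acc; acc)
open import Relation.Nullary using (¬_; Dec; yes; no; ¬?; contradiction)
open import Relation.Nullary.Decidable using (_×-dec_; _⊎-dec_)
open import Relation.Binary.PropositionalEquality using (_≡_; refl; sym; trans; cong; cong₂; subst; subst₂; module ≡-Reasoning)

length-three-way : {A : Set} {P Q : A → Set}
  (P? : ∀ x → Dec (P x)) (Q? : ∀ x → Dec (Q x)) (xs : List A) →
  (∀ {x} → x ∈ xs → P x → ¬ Q x) →
  length xs ≡ length (filter P? xs) + length (filter Q? xs)
              + length (filter (λ x → ¬? (P? x ⊎-dec Q? x)) xs)
length-three-way P? Q? [] disjoint = refl
length-three-way P? Q? (x ∷ xs) disjoint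
  with P? x | Q? x | length-three-way P? Q? xs (λ x∈ → disjoint (there x∈))
... | yes p | yes q | _  = contradiction q (disjoint (here refl) p)
... | yes _ | no _  | ih = cong suc ih
... | no _  | yes _ | ih = trans (cong suc ih) (cong (_+ #R) (sym (+-suc #P _)))
  where #P = length (filter P? xs); #R = length (filter (λ x → ¬? (P? x ⊎-dec Q? x)) xs)
... | no _  | no _  | ih = trans (cong suc ih) (sym (+-suc (#P + #Q) _))
  where #P = length (filter P? xs); #Q = length (filter Q? xs)

unique-singleton-length : {A : Set} {x : A} (xs : List A) → Unique xs →
  x ∈ xs → (∀ {y} → y ∈ xs → y ≡ x) → length xs ≡ 1
unique-singleton-length (a ∷ []) _ _ _ = refl
unique-singleton-length (a ∷ b ∷ _) ((a≢b ∷ _) ∷ _) _ only =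
  contradiction (trans (only (here refl)) (sym (only (there (here refl))))) a≢b

record LargestWitness (P : ℕ → Set) (w : ℕ) : Set where
  field
    value   : ℕ
    bounded : value ≤ w
    holds   : P value
    largest : ∀ {e} → value < e → e ≤ w → ¬ P e

largest-witness : (P : ℕ → Set) → (∀ e → Dec (P e)) → P 0 → ∀ w → LargestWitness P w
largest-witness P P? p0 zero = record
  { value = 0 ; bounded = z≤n ; holds = p0 ; largest = λ { 0<e z≤n → contradiction 0<e (<-irrefl refl) } }
largest-witness P P? p0 (suc w) with P? (suc w)
... | yes pw = record
  { value = suc w ; bounded = ≤-refl ; holds = pw ; largest = λ w<e e≤w → contradiction e≤w (<⇒≱ w<e) }
... | no ¬pw = record { value = value ; bounded = m≤n⇒m≤1+n bounded ; holds = holds ; largest = larger }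
  where
  open LargestWitness (largest-witness P P? p0 w)
  larger : ∀ {e} → value < e → e ≤ suc w → ¬ P e
  larger v<e e≤1+w with m≤n⇒m<n∨m≡n e≤1+w
  ... | inj₁ e≤w  = largest v<e (≤-pred e≤w)
  ... | inj₂ refl = ¬pw

Crossing : ℕ → ℕ → ℕ → ℕ → Set
Crossing a b c d = a < c × c ≤ b × b < d

Apart : ℕ → ℕ → ℕ → ℕ → Set
Apart a b c d = ¬ Crossing a b c d × ¬ Crossing c d a b

apart-sym : ∀ {a b c d} → Apart a b c d → Apart c d a b
apart-sym (¬ab , ¬cd) = ¬cd , ¬ab

crossing-irrefl : ∀ {a b} → ¬ Crossing a b a b
crossing-irrefl (a<a , _) = <-irrefl refl a<a

nested⇒apart : ∀ {a b c d} → a ≤ c → d ≤ b → Apart a b c d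
nested⇒apart a≤c d≤b = (λ (_ , _ , b<d) → <⇒≱ b<d d≤b) ,
                       (λ (c<a , _ , _) → <⇒≱ c<a a≤c)

point⇒apart : ∀ {a c d} → Apart a a c d
point⇒apart = (λ (a<c , c≤a , _) → <⇒≱ a<c c≤a) ,
              (λ (_ , a≤d , d<a) → <⇒≱ d<a a≤d)

disjoint⇒apart : ∀ {a b c d} → c ≤ d → d < a → Apart a b c d
disjoint⇒apart c≤d d<a = (λ (a<c , _ , _) → <⇒≱ (<-trans a<c (≤-<-trans c≤d d<a)) ≤-refl) ,
                         (λ (_ , a≤d , _) → <⇒≱ d<a a≤d)

-- If [c , d] ⊆ [a , b] and [e , f] is apart from [a , b] without lying inside
-- it, then [e , f] is apart from [c , d]: it either contains [a , b] or is
-- disjoint from it.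
outside⇒apart : ∀ {a b c d e f} → a ≤ c → d ≤ b → Apart a b e f →
  ¬ (a ≤ e × f ≤ b) → Apart c d e f
outside⇒apart a≤c d≤b (¬ab-ef , ¬ef-ab) outside =
  (λ (c<e , e≤d , d<f) → ¬ab-ef (≤-<-trans a≤c c<e , ≤-trans e≤d d≤b ,
                                  ≰⇒> (λ f≤b → outside (<⇒≤ (≤-<-trans a≤c c<e) , f≤b)))) ,
  (λ (e<c , c≤f , f<d) → ¬ef-ab (≰⇒> (λ a≤e → outside (a≤e , <⇒≤ (<-≤-trans f<d d≤b))) ,
                                  ≤-trans a≤c c≤f , <-≤-trans f<d d≤b))

record IntervalModel (D : BoxSet) (N : ℕ) : Set where
  field
    lo hi      : Box → ℕ
    bounds     : ∀ {x} → D x → 1 ≤ lo x × lo x ≤ hi x × hi x ≤ N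
    injective  : ∀ {x y} → D x → D y → lo x ≡ lo y → hi x ≡ hi y → x ≡ y
    surjective : ∀ {a b} → 1 ≤ a → a ≤ b → b ≤ N →
                 Σ Box λ x → D x × lo x ≡ a × hi x ≡ b
    crossing⇒adjacent : ∀ {x y} → D x → D y →
                 Crossing (lo x) (hi x) (lo y) (hi y) → DowncoreAdj D x y
    adjacent⇒crossing : ∀ {x y} → D x → D y → DowncoreAdj D x y →
                 Crossing (lo x) (hi x) (lo y) (hi y) ⊎ Crossing (lo y) (hi y) (lo x) (hi x)

module Laminar {D : BoxSet} {N : ℕ} (M : IntervalModel D N) where
  open IntervalModel M

  lo≤hi : ∀ {x} → D x → lo x ≤ hi x
  lo≤hi Dx = proj₁ (proj₂ (bounds Dx))

  Crosses : Box → Box → Set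
  Crosses x y = Crossing (lo x) (hi x) (lo y) (hi y)

  Separated : Box → Box → Set
  Separated x y = Apart (lo x) (hi x) (lo y) (hi y)

  Compatible : List Box → Box → Set
  Compatible S x = ∀ {y} → y ∈ S → Separated x y

  Inside : ℕ → ℕ → Box → Set
  Inside a b x = a ≤ lo x × hi x ≤ b

  inside? : ∀ a b x → Dec (Inside a b x)
  inside? a b x = (a ≤? lo x) ×-dec (hi x ≤? b)

  Within : ℕ → ℕ → Box → Set
  Within a b x = D x × Inside a b x

  record Codes (a b : ℕ) (x : Box) : Set where
    constructor codes
    field
      domain : D x
      lo≡    : lo x ≡ a
      hi≡    : hi x ≡ b

  interval : ∀ {a b} → 1 ≤ a → a ≤ b → b ≤ N → Box
  interval 1≤a a≤b b≤N = proj₁ (surjective 1≤a a≤b b≤N)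

  interval-codes : ∀ {a b} (1≤a : 1 ≤ a) (a≤b : a ≤ b) (b≤N : b ≤ N) →
    Codes a b (interval 1≤a a≤b b≤N)
  interval-codes 1≤a a≤b b≤N with surjective 1≤a a≤b b≤N
  ... | _ , Dx , lo≡ , hi≡ = codes Dx lo≡ hi≡

  nested-codes : ∀ {a b c d x y} → Codes a b x → Codes c d y → a ≤ c → d ≤ b → Separated x y
  nested-codes (codes _ refl refl) (codes _ refl refl) = nested⇒apart

  record MaxLaminar (p q : ℕ) (S : List Box) : Set where
    field
      unique  : Unique S
      within  : ∀ {x} → x ∈ S → Within p q x
      laminar : ∀ {x y} → x ∈ S → y ∈ S → ¬ Crosses x y
      maximal : ∀ {x} → Within p q x → Compatible S x → x ∈ S

    member-in-D : ∀ {x} → x ∈ S → D x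
    member-in-D x∈S = proj₁ (within x∈S)

    member-starts : ∀ {x} → x ∈ S → p ≤ lo x
    member-starts x∈S = proj₁ (proj₂ (within x∈S))

    member-ends : ∀ {x} → x ∈ S → hi x ≤ q
    member-ends x∈S = proj₂ (proj₂ (within x∈S))

  -- The whole window is a member: it contains every other interval.
  window-member : ∀ {p q S t} → MaxLaminar p q S → Codes p q t → t ∈ S
  window-member ML (codes Dt refl refl) =
    maximal (Dt , ≤-refl , ≤-refl) (λ y∈S → nested⇒apart (member-starts y∈S) (member-ends y∈S))
    where open MaxLaminar ML

  -- Every one-point interval of the window is a member: it crosses nothing.
  point-member : ∀ {p q S a x} → MaxLaminar p q S → p ≤ a → a ≤ q → Codes a a x → x ∈ S
  point-member {q = q} {x = x} ML p≤a a≤q (codes Dx refl hi≡lo) =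
    maximal (Dx , p≤a , subst (_≤ q) (sym hi≡lo) a≤q)
            (λ {y} _ → subst (λ h → Apart (lo x) h (lo y) (hi y)) (sym hi≡lo) point⇒apart)
    where open MaxLaminar ML

  -- The members of S inside a member [a , b] form a maximal laminar family
  -- of [a , b]: any other member of S either contains [a , b] or is
  -- disjoint from it, hence is apart from every interval inside [a , b].
  restrict : ∀ {p q S z a b} → MaxLaminar p q S → z ∈ S → Codes a b z →
    MaxLaminar a b (filter (inside? a b) S)
  restrict {p} {q} {S} {z} {a} {b} ML z∈S (codes _ refl refl) = record
    { unique  = Unique.filter⁺ (inside? a b) unique
    ; within  = λ x∈ → let (x∈S , x-inside) = ∈-filter⁻ (inside? a b) x∈ in
                       member-in-D x∈S , x-inside
    ; laminar = λ x∈ y∈ → laminar (proj₁ (∈-filter⁻ (inside? a b) x∈))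
                                  (proj₁ (∈-filter⁻ (inside? a b) y∈))
    ; maximal = λ (Dx , x-inside) compatible →
        ∈-filter⁺ (inside? a b) (maximal (Dx , widen x-inside) (compatible-with-S x-inside compatible))
                  x-inside
    }
    where
    open MaxLaminar ML

    widen : ∀ {x} → Inside a b x → Inside p q x
    widen (a≤x , x≤b) = ≤-trans (member-starts z∈S) a≤x , ≤-trans x≤b (member-ends z∈S)

    compatible-with-S : ∀ {x} → Inside a b x → Compatible (filter (inside? a b) S) x → Compatible S x
    compatible-with-S (a≤x , x≤b) compatible {y} y∈S with inside? a b y
    ... | yes y-inside = compatible (∈-filter⁺ (inside? a b) y∈S y-inside)
    ... | no y-outside = outside⇒apart a≤x x≤b (laminar z∈S y∈S , laminar y∈S z∈S) y-outside

  single-point-window : ∀ {p S} → 1 ≤ p → p ≤ N → MaxLaminar p p S → length S ≡ 1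
  single-point-window {p} {S} 1≤p p≤N ML =
    unique-singleton-length S unique (point-member ML ≤-refl ≤-refl s-codes) is-s
    where
    open MaxLaminar ML
    s = interval 1≤p ≤-refl p≤N
    s-codes = interval-codes 1≤p ≤-refl p≤N
    module s = Codes s-codes
    is-s : ∀ {x} → x ∈ S → x ≡ s
    is-s x∈S = injective (member-in-D x∈S) s.domain (trans lo≡p (sym s.lo≡)) (trans hi≡p (sym s.hi≡))
      where
      lo≤hi-x = lo≤hi (member-in-D x∈S)
      lo≡p = ≤-antisym (≤-trans lo≤hi-x (member-ends x∈S)) (member-starts x∈S)
      hi≡p = ≤-antisym (member-ends x∈S) (≤-trans (member-starts x∈S) lo≤hi-x)

  module Split {p w S} (1≤p : 1 ≤ p) (q≤N : p + suc w ≤ N) (ML : MaxLaminar p (p + suc w) S) where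
    open MaxLaminar ML

    q : ℕ
    q = p + suc w

    p≤q : p ≤ q
    p≤q = m≤m+n p (suc w)

    HasStart : ℕ → Set
    HasStart e = Any (λ x → lo x ≡ p × hi x ≡ p + e) S

    has-start? : ∀ e → Dec (HasStart e)
    has-start? e = any? (λ x → (lo x ≟ p) ×-dec (hi x ≟ p + e)) S

    has-point : HasStart 0
    has-point = Any.map (λ { refl → s.lo≡ , trans s.hi≡ (sym (+-identityʳ p)) })
                        (point-member ML ≤-refl p≤q s-codes)
      where
      s-codes = interval-codes 1≤p ≤-refl (≤-trans p≤q q≤N)
      module s = Codes s-codes

    open LargestWitness (largest-witness HasStart has-start? has-point w) public
      renaming (value to e; bounded to e≤w; holds to has-e; largest to longest)

    m : ℕ
    m = p + e

    m<q : m < q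
    m<q = +-monoʳ-< p (s≤s e≤w)

    p≤1+m : p ≤ suc m
    p≤1+m = m≤n⇒m≤1+n (m≤m+n p e)

    left-member : Σ Box λ L → L ∈ S × lo L ≡ p × hi L ≡ m
    left-member = find has-e

    t : Box
    t = interval 1≤p p≤q q≤N

    t-codes : Codes p q t
    t-codes = interval-codes 1≤p p≤q q≤N

    module t = Codes t-codes

    -- A member straddling m must start at p, else it would cross [p , m] ...
    straddler-starts-at-p : ∀ {y} → y ∈ S → lo y ≤ m → m < hi y → lo y ≡ p
    straddler-starts-at-p {y} y∈S lo≤m m<hi with m≤n⇒m<n∨m≡n (member-starts y∈S) | left-member
    ... | inj₂ p≡lo | _ = sym p≡lo
    ... | inj₁ p<lo | L , L∈S , lo-L , hi-L =
      contradiction (subst₂ (λ a b → Crossing a b (lo y) (hi y)) (sym lo-L) (sym hi-L) (p<lo , lo≤m , m<hi))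
                    (laminar L∈S y∈S)

    -- ... and must end at q, else it would be a longer member starting at p.
    straddler-ends-at-q : ∀ {y} → y ∈ S → lo y ≡ p → m < hi y → hi y ≡ q
    straddler-ends-at-q {y} y∈S lo≡p m<hi with hi y ≟ q
    ... | yes hi≡q = hi≡q
    ... | no hi≢q  = contradiction has-e′ (longest e<e′ e′≤w)
      where
      p≤hi : p ≤ hi y
      p≤hi = ≤-trans (≤-reflexive (sym lo≡p)) (lo≤hi (member-in-D y∈S))
      e′ : ℕ
      e′ = hi y ∸ p
      p+e′≡hi : p + e′ ≡ hi y
      p+e′≡hi = m+[n∸m]≡n p≤hi
      e<e′ : e < e′
      e<e′ = +-cancelˡ-< p e e′ (subst (m <_) (sym p+e′≡hi) m<hi)
      e′≤w : e′ ≤ w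
      e′≤w = +-cancelˡ-≤ p e′ w (subst (_≤ p + w) (sym p+e′≡hi)
               (≤-pred (subst (hi y <_) (+-suc p w) (≤∧≢⇒< (member-ends y∈S) hi≢q))))
      has-e′ : HasStart e′
      has-e′ = Any.map (λ { refl → lo≡p , sym p+e′≡hi }) y∈S

    only-window-straddles : ∀ {y} → y ∈ S → ¬ Inside p m y → ¬ Inside (suc m) q y → y ≡ t
    only-window-straddles {y} y∈S not-left not-right =
      injective (member-in-D y∈S) t.domain (trans lo≡p (sym t.lo≡))
                (trans (straddler-ends-at-q y∈S lo≡p m<hi) (sym t.hi≡))
      where
      m<hi : m < hi y
      m<hi = ≰⇒> (λ hi≤m → not-left (member-starts y∈S , hi≤m))
      lo≤m : lo y ≤ m
      lo≤m = ≮⇒≥ (λ m<lo → not-right (m<lo , member-ends y∈S))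
      lo≡p : lo y ≡ p
      lo≡p = straddler-starts-at-p y∈S lo≤m m<hi

    r : Box
    r = interval (s≤s z≤n) m<q q≤N

    r-codes : Codes (suc m) q r
    r-codes = interval-codes (s≤s z≤n) m<q q≤N

    module r = Codes r-codes

    -- [m+1 , q] is a member: members inside [p , m] are disjoint from it,
    -- the remaining ones contain it or lie inside it.
    right-member : r ∈ S
    right-member = maximal (r.domain , ≤-trans p≤1+m (≤-reflexive (sym r.lo≡)) , ≤-reflexive r.hi≡) compatible
      where
      compatible : Compatible S r
      compatible {y} y∈S with inside? p m y | inside? (suc m) q y
      ... | yes (_ , hi≤m) | _ =
        disjoint⇒apart (lo≤hi (member-in-D y∈S)) (≤-trans (s≤s hi≤m) (≤-reflexive (sym r.lo≡)))
      ... | no _ | yes (m<lo , hi≤q) =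
        nested⇒apart (≤-trans (≤-reflexive r.lo≡) m<lo) (≤-trans hi≤q (≤-reflexive (sym r.hi≡)))
      ... | no not-left | no not-right =
        subst (Separated r) (sym (only-window-straddles y∈S not-left not-right))
          (apart-sym (nested-codes t-codes r-codes p≤1+m ≤-refl))

    S₁ S₂ : List Box
    S₁ = filter (inside? p m) S
    S₂ = filter (inside? (suc m) q) S

    left : MaxLaminar p (p + e) S₁
    left with left-member
    ... | L , L∈S , lo-L , hi-L = restrict ML L∈S (codes (member-in-D L∈S) lo-L hi-L)

    w₂ : ℕ
    w₂ = w ∸ e

    widths : e + w₂ ≡ w
    widths = m+[n∸m]≡n e≤w

    right-end : suc m + w₂ ≡ q
    right-end = begin
      suc (p + e) + w₂     ≡⟨ cong suc (+-assoc p e w₂) ⟩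
      suc (p + (e + w₂))   ≡⟨ cong (λ k → suc (p + k)) widths ⟩
      suc (p + w)          ≡⟨ sym (+-suc p w) ⟩
      p + suc w            ∎
      where open ≡-Reasoning

    right : MaxLaminar (suc m) (suc m + w₂) S₂
    right = subst (λ b → MaxLaminar (suc m) b S₂) (sym right-end) (restrict ML right-member r-codes)

    decomposition : length S ≡ length S₁ + length S₂ + 1
    decomposition =
      trans (length-three-way (inside? p m) (inside? (suc m) q) S sides-disjoint)
            (cong (length S₁ + length S₂ +_)
                  (unique-singleton-length _ (Unique.filter⁺ straddles? unique) t-straddles straddler-is-t))
      where
      sides-disjoint : ∀ {x} → x ∈ S → Inside p m x → ¬ Inside (suc m) q x
      sides-disjoint x∈S (_ , hi≤m) (m<lo , _) = <⇒≱ m<lo (≤-trans (lo≤hi (member-in-D x∈S)) hi≤m)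
      straddles? : ∀ x → Dec (¬ (Inside p m x ⊎ Inside (suc m) q x))
      straddles? x = ¬? (inside? p m x ⊎-dec inside? (suc m) q x)
      t-straddles : t ∈ filter straddles? S
      t-straddles = ∈-filter⁺ straddles? (window-member ML t-codes) λ
        { (inj₁ (_ , hi≤m)) → <⇒≱ m<q (≤-trans (≤-reflexive (sym t.hi≡)) hi≤m)
        ; (inj₂ (m<lo , _)) → <⇒≱ m<lo (≤-trans (≤-reflexive t.lo≡) (m≤m+n p e)) }
      straddler-is-t : ∀ {y} → y ∈ filter straddles? S → y ≡ t
      straddler-is-t y∈ with ∈-filter⁻ straddles? y∈
      ... | y∈S , neither = only-window-straddles y∈S (λ l → neither (inj₁ l)) (λ r → neither (inj₂ r))

  maxLaminar-size : ∀ w → Acc _<_ w → ∀ {p S} → 1 ≤ p → p + w ≤ N →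
    MaxLaminar p (p + w) S → length S ≡ suc (2 * w)
  maxLaminar-size zero _ {p} {S} 1≤p p≤N ML =
    single-point-window 1≤p (subst (_≤ N) (+-identityʳ p) p≤N)
      (subst (λ b → MaxLaminar p b S) (+-identityʳ p) ML)
  maxLaminar-size (suc w) (acc smaller) {p} {S} 1≤p q≤N ML = begin
    length S                       ≡⟨ decomposition ⟩
    length S₁ + length S₂ + 1      ≡⟨ cong₂ (λ a b → a + b + 1) size₁ size₂ ⟩
    suc (2 * e) + suc (2 * w₂) + 1 ≡⟨ halves e w₂ ⟩
    suc (2 * suc (e + w₂))         ≡⟨ cong (λ k → suc (2 * suc k)) widths ⟩
    suc (2 * suc w)                ∎
    where
    open Split 1≤p q≤N ML
    open ≡-Reasoning
    size₁ : length S₁ ≡ suc (2 * e)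
    size₁ = maxLaminar-size e (smaller (s≤s e≤w)) 1≤p
              (≤-trans (+-monoʳ-≤ p (m≤n⇒m≤1+n e≤w)) q≤N) left
    size₂ : length S₂ ≡ suc (2 * w₂)
    size₂ = maxLaminar-size w₂ (smaller (s≤s (m∸n≤m w e))) (s≤s z≤n)
              (subst (_≤ N) (sym right-end) q≤N) right
    halves : ∀ a b → suc (2 * a) + suc (2 * b) + 1 ≡ suc (2 * suc (a + b))
    halves = solve-∀

  separated⇒nonadjacent : ∀ {x y} → D x → D y → Separated x y → ¬ DowncoreAdj D x y
  separated⇒nonadjacent Dx Dy (¬x-y , ¬y-x) adjacent with adjacent⇒crossing Dx Dy adjacent
  ... | inj₁ x-y = ¬x-y x-y
  ... | inj₂ y-x = ¬y-x y-x

  maximalIndependent⇒maxLaminar : ∀ {S} → MaximalIndependent D S → MaxLaminar 1 N S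
  maximalIndependent⇒maxLaminar {S} ((unique , all-D , independent) , maximal-independent) = record
    { unique  = unique
    ; within  = λ x∈S → let Dx = All.lookup all-D x∈S ; (1≤lo , _ , hi≤N) = bounds Dx in Dx , 1≤lo , hi≤N
    ; laminar = λ x∈S y∈S x-y →
        independent _ _ x∈S y∈S (crossing⇒adjacent (All.lookup all-D x∈S) (All.lookup all-D y∈S) x-y)
    ; maximal = add-compatible
    }
    where
    -- A compatible box cannot be missing: adding it would keep S independent.
    add-compatible : ∀ {x} → Within 1 N x → Compatible S x → x ∈ S
    add-compatible {x} (Dx , _) compatible with x ∈? S
    ... | yes x∈S = x∈S
    ... | no x∉S  = maximal-independent (x ∷ S)
                      ((¬Any⇒All¬ S x∉S ∷ unique) , (Dx ∷ all-D) , extended) (λ _ → there) x (here refl)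
      where
      extended : ∀ u v → u ∈ x ∷ S → v ∈ x ∷ S → ¬ DowncoreAdj D u v
      extended u v (here refl) (here refl) = separated⇒nonadjacent Dx Dx (crossing-irrefl , crossing-irrefl)
      extended u v (here refl) (there v∈S) =
        separated⇒nonadjacent Dx (All.lookup all-D v∈S) (compatible v∈S)
      extended u v (there u∈S) (here refl) =
        separated⇒nonadjacent (All.lookup all-D u∈S) Dx (apart-sym (compatible u∈S))
      extended u v (there u∈S) (there v∈S) = independent u v u∈S v∈S

pure-of-size : ∀ {D n} → IntervalModel D (suc n) → PureOfSize D (suc n)
pure-of-size {D} {n} M = (λ S T S-max T-max → trans (size S S-max) (sym (size T T-max))) , size
  where
  open Laminar M
  size : ∀ S → MaximalIndependent D S → length S ≡ 2 * suc n ∸ 1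
  size _ S-max = trans (maxLaminar-size n (<-wellFounded n) (s≤s z≤n) ≤-refl
                        (maximalIndependent⇒maxLaminar S-max))
                     (sym (+-suc n (n + 0)))   -- 2 (n + 1) ∸ 1 ≡ 2 n + 1

module Reflection (n : ℕ) where
  K : ℕ
  K = n + 1

  ≤n⇒≤K : ∀ {j} → j ≤ n → j ≤ K
  ≤n⇒≤K j≤n = ≤-trans j≤n (m≤m+n n 1)

  reflect-positive : ∀ {j} → j ≤ n → 1 ≤ K ∸ j
  reflect-positive {j} j≤n = subst (_≤ K ∸ j) (m+n∸m≡n n 1) (∸-monoʳ-≤ K j≤n)

  reflect-≤n : ∀ {j} → 1 ≤ j → K ∸ j ≤ n
  reflect-≤n {j} 1≤j = subst (K ∸ j ≤_) (m+n∸n≡m n 1) (∸-monoʳ-≤ K 1≤j)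

  reflect-injective : ∀ {j l} → j ≤ n → l ≤ n → K ∸ j ≡ K ∸ l → j ≡ l
  reflect-injective j≤n l≤n = ∸-cancelˡ-≡ (≤n⇒≤K j≤n) (≤n⇒≤K l≤n)

  reflect-reverses : ∀ {j l} → K ∸ j < K ∸ l → l < j
  reflect-reverses reflected = ≰⇒> (λ j≤l → <⇒≱ reflected (∸-monoʳ-≤ K j≤l))

  k≤K∸j⇒k+j≤K : ∀ {j k} → j ≤ K → k ≤ K ∸ j → k + j ≤ K
  k≤K∸j⇒k+j≤K {j} j≤K k≤K∸j = ≤-trans (+-monoˡ-≤ j k≤K∸j) (≤-reflexive (m∸n+n≡m j≤K))

  K≤i+j⇒K∸j≤i : ∀ {i j} → K ≤ i + j → K ∸ j ≤ i
  K≤i+j⇒K∸j≤i {i} {j} K≤i+j = m≤n+o⇒m∸n≤o K j (subst (K ≤_) (+-comm i j) K≤i+j)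

  K∸l≤i⇒K≤i+l : ∀ {i l} → K ∸ l ≤ i → K ≤ i + l
  K∸l≤i⇒K≤i+l {i} {l} K∸l≤i = ≤-trans (m≤n+m∸n K l) (≤-trans (+-monoʳ-≤ l K∸l≤i) (≤-reflexive (+-comm l i)))

module Lower (n : ℕ) where
  open Reflection n

  model : IntervalModel (StairLower n) n
  model = record
    { lo = lo ; hi = hi ; bounds = bounds ; injective = injective ; surjective = surjective
    ; crossing⇒adjacent = crossing⇒adjacent ; adjacent⇒crossing = adjacent⇒crossing }
    where
    lo hi : Box → ℕ
    lo (i , _) = i
    hi (_ , j) = K ∸ j

    bounds : ∀ {x} → StairLower n x → 1 ≤ lo x × lo x ≤ hi x × hi x ≤ n
    bounds {i , j} (1≤i , _ , 1≤j , _ , i+j≤K) = 1≤i , m+n≤o⇒m≤o∸n i i+j≤K , reflect-≤n 1≤j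

    injective : ∀ {x y} → StairLower n x → StairLower n y → lo x ≡ lo y → hi x ≡ hi y → x ≡ y
    injective {i , j} {_ , l} (_ , _ , _ , j≤n , _) (_ , _ , _ , l≤n , _) refl reflected =
      cong (i ,_) (reflect-injective j≤n l≤n reflected)

    surjective : ∀ {a b} → 1 ≤ a → a ≤ b → b ≤ n →
      Σ Box λ x → StairLower n x × lo x ≡ a × hi x ≡ b
    surjective {a} {b} 1≤a a≤b b≤n =
      (a , K ∸ b) ,
      (1≤a , ≤-trans a≤b b≤n , reflect-positive b≤n , reflect-≤n (≤-trans 1≤a a≤b) ,
       ≤-trans (+-monoˡ-≤ (K ∸ b) a≤b) (≤-reflexive (m+[n∸m]≡n (≤n⇒≤K b≤n)))) ,
      refl , m∸[m∸n]≡n (≤n⇒≤K b≤n)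

    crossing⇒adjacent : ∀ {x y} → StairLower n x → StairLower n y →
      Crossing (lo x) (hi x) (lo y) (hi y) → DowncoreAdj (StairLower n) x y
    crossing⇒adjacent {i , j} {k , l} (1≤i , i≤n , 1≤j , j≤n , _) (1≤k , k≤n , 1≤l , l≤n , _)
                      (i<k , k≤K∸j , reflected) =
      inj₁ (i<k , l<j) ,
      (1≤i , i≤n , 1≤l , l≤n , ≤-trans (+-mono-≤ (<⇒≤ i<k) (<⇒≤ l<j)) k+j≤K) ,
      (1≤k , k≤n , 1≤j , j≤n , k+j≤K)
      where
      l<j = reflect-reverses reflected
      k+j≤K = k≤K∸j⇒k+j≤K (≤n⇒≤K j≤n) k≤K∸j

    adjacent⇒crossing : ∀ {x y} → StairLower n x → StairLower n y → DowncoreAdj (StairLower n) x y →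
      Crossing (lo x) (hi x) (lo y) (hi y) ⊎ Crossing (lo y) (hi y) (lo x) (hi x)
    adjacent⇒crossing {i , j} {k , l} (_ , _ , _ , j≤n , _) _ (inj₁ (i<k , l<j) , _ , (_ , _ , _ , _ , k+j≤K)) =
      inj₁ (i<k , m+n≤o⇒m≤o∸n k k+j≤K , ∸-monoʳ-< l<j (≤n⇒≤K j≤n))
    adjacent⇒crossing {i , j} {k , l} _ (_ , _ , _ , l≤n , _) (inj₂ (k<i , j<l) , (_ , _ , _ , _ , i+l≤K) , _) =
      inj₂ (k<i , m+n≤o⇒m≤o∸n i i+l≤K , ∸-monoʳ-< j<l (≤n⇒≤K l≤n))

module Upper (n : ℕ) where
  open Reflection n

  model : IntervalModel (StairUpper n) n
  model = record
    { lo = lo ; hi = hi ; bounds = bounds ; injective = injective ; surjective = surjective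
    ; crossing⇒adjacent = crossing⇒adjacent ; adjacent⇒crossing = adjacent⇒crossing }
    where
    lo hi : Box → ℕ
    lo (_ , j) = K ∸ j
    hi (i , _) = i

    bounds : ∀ {x} → StairUpper n x → 1 ≤ lo x × lo x ≤ hi x × hi x ≤ n
    bounds {i , j} (_ , i≤n , _ , j≤n , K≤i+j) = reflect-positive j≤n , K≤i+j⇒K∸j≤i K≤i+j , i≤n

    injective : ∀ {x y} → StairUpper n x → StairUpper n y → lo x ≡ lo y → hi x ≡ hi y → x ≡ y
    injective {i , j} {_ , l} (_ , _ , _ , j≤n , _) (_ , _ , _ , l≤n , _) reflected refl =
      cong (i ,_) (reflect-injective j≤n l≤n reflected)

    surjective : ∀ {a b} → 1 ≤ a → a ≤ b → b ≤ n →
      Σ Box λ x → StairUpper n x × lo x ≡ a × hi x ≡ b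
    surjective {a} {b} 1≤a a≤b b≤n =
      (b , K ∸ a) ,
      (≤-trans 1≤a a≤b , b≤n , reflect-positive a≤n , reflect-≤n 1≤a ,
       ≤-trans (≤-reflexive (sym (m+[n∸m]≡n (≤n⇒≤K a≤n)))) (+-monoˡ-≤ (K ∸ a) a≤b)) ,
      m∸[m∸n]≡n (≤n⇒≤K a≤n) , refl
      where
      a≤n = ≤-trans a≤b b≤n

    crossing⇒adjacent : ∀ {x y} → StairUpper n x → StairUpper n y →
      Crossing (lo x) (hi x) (lo y) (hi y) → DowncoreAdj (StairUpper n) x y
    crossing⇒adjacent {i , j} {k , l} (1≤i , i≤n , 1≤j , j≤n , K≤i+j) (1≤k , k≤n , 1≤l , l≤n , _)
                      (reflected , K∸l≤i , i<k) =
      inj₁ (i<k , reflect-reverses reflected) ,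
      (1≤i , i≤n , 1≤l , l≤n , K∸l≤i⇒K≤i+l K∸l≤i) ,
      (1≤k , k≤n , 1≤j , j≤n , ≤-trans K≤i+j (+-monoˡ-≤ j (<⇒≤ i<k)))

    adjacent⇒crossing : ∀ {x y} → StairUpper n x → StairUpper n y → DowncoreAdj (StairUpper n) x y →
      Crossing (lo x) (hi x) (lo y) (hi y) ⊎ Crossing (lo y) (hi y) (lo x) (hi x)
    adjacent⇒crossing {i , j} {k , l} (_ , _ , _ , j≤n , _) _ (inj₁ (i<k , l<j) , (_ , _ , _ , _ , K≤i+l) , _) =
      inj₁ (∸-monoʳ-< l<j (≤n⇒≤K j≤n) , K≤i+j⇒K∸j≤i K≤i+l , i<k)
    adjacent⇒crossing {i , j} {k , l} _ (_ , _ , _ , l≤n , _) (inj₂ (k<i , j<l) , _ , (_ , _ , _ , _ , K≤k+j)) =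
      inj₂ (∸-monoʳ-< j<l (≤n⇒≤K l≤n) , K≤i+j⇒K∸j≤i K≤k+j , k<i)

theorem3p13 : (n : ℕ) → 1 ≤ n → PureOfSize (StairLower n) n × PureOfSize (StairUpper n) n
theorem3p13 (suc n) _ = pure-of-size (Lower.model (suc n)) , pure-of-size (Upper.model (suc n))
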